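{- Let $D_1,D_2$ be digraphs such that $D_1$ is a cut minor of $D_2$. If $D_2$ admits an odd dijoin, then so does $D_1$.
   Context: Digraphs may have loops and multiple edges. A bond is an inclusion-minimal nonempty edge cut $D[X,Y]$; it is directed if all its edges go from $X$ to $Y$. An odd dijoin is a set $J$ of edges with $|J\cap S|$ odd for every directed bond $S$. Contracting an edge set $A$: delete $A$ and identify each weak component of $D[A]$ to a vertex. A non-loop edge $(x,y)$ is deletable if there is a directed $x$–$y$ path avoiding it. A cut minor is obtained by a finite sequence of edge contractions, deletions of deletable edges and deletions of isolated vertices. -}

module Defs where

open import Data.Nat using (ℕ; suc; _%_)
open import Data.Fin using (Fin)
open import Data.Bool using (Bool; true; false; _xor_)
open import Data.Vec using (lookup; tabulate)
open import Data.Fin.Subset using (Subset; _∈_; _∉_; _⊆_; _∩_; ∣_∣; Nonempty)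
open import Data.Product using (Σ; ∃; _×_; _,_)
open import Relation.Binary.PropositionalEquality using (_≡_; _≢_)
open import Relation.Nullary using (¬_)
open import Function using (_⇔_)
open import Function.Definitions using (Injective; Surjective)
open import Relation.Binary.Construct.Closure.ReflexiveTransitive using (Star)

record Digraph : Set where
  field
    nV   : ℕ
    nE   : ℕ
    tail : Fin nE → Fin nV
    head : Fin nE → Fin nV
open Digraph public

cut : (D : Digraph) → Subset (nV D) → Subset (nE D)
cut D X = tabulate (λ e → lookup X (tail D e) xor lookup X (head D e))

IsBond : (D : Digraph) → Subset (nE D) → Set
IsBond D S =
  (∃ λ X → S ≡ cut D X) × Nonempty S ×
  (∀ X → Nonempty (cut D X) → cut D X ⊆ S → S ⊆ cut D X)

IsDirectedBond : (D : Digraph) → Subset (nE D) → Set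
IsDirectedBond D S =
  IsBond D S ×
  (∃ λ X → (S ≡ cut D X) × (∀ e → e ∈ S → lookup X (tail D e) ≡ true))

IsOddDijoin : (D : Digraph) → Subset (nE D) → Set
IsOddDijoin D J = ∀ S → IsDirectedBond D S → ∣ J ∩ S ∣ % 2 ≡ 1

HasOddDijoin : Digraph → Set
HasOddDijoin D = ∃ λ J → IsOddDijoin D J

data WConn (D : Digraph) (A : Subset (nE D)) : Fin (nV D) → Fin (nV D) → Set where
  here : ∀ {u} → WConn D A u u
  fwd  : ∀ {w} e → e ∈ A → WConn D A (head D e) w → WConn D A (tail D e) w
  bwd  : ∀ {w} e → e ∈ A → WConn D A (tail D e) w → WConn D A (head D e) w

data DPathAvoid (D : Digraph) (f : Fin (nE D)) : Fin (nV D) → Fin (nV D) → Set where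
  here : ∀ {u} → DPathAvoid D f u u
  step : ∀ {w} e → e ≢ f → DPathAvoid D f (head D e) w → DPathAvoid D f (tail D e) w

-- D' is (isomorphic to) the result of contracting the edge set A in D:
-- A is deleted and each weak component of D[A] is identified to a vertex.
ContractionOf : (D D' : Digraph) → Set
ContractionOf D D' =
  Σ (Subset (nE D)) λ A →
  Σ (Fin (nV D) → Fin (nV D')) λ φ →
  Σ (Fin (nE D') → Fin (nE D)) λ ψ →
    Surjective _≡_ _≡_ φ ×
    (∀ u v → (φ u ≡ φ v) ⇔ WConn D A u v) ×
    Injective _≡_ _≡_ ψ ×
    (∀ e → ψ e ∉ A) ×
    (∀ f → f ∉ A → ∃ λ e → ψ e ≡ f) ×
    (∀ e → tail D' e ≡ φ (tail D (ψ e))) ×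
    (∀ e → head D' e ≡ φ (head D (ψ e)))

DeletableEdgeDeletionOf : (D D' : Digraph) → Set
DeletableEdgeDeletionOf D D' =
  Σ (Fin (nE D)) λ f →
  Σ (Fin (nV D') → Fin (nV D)) λ φ →
  Σ (Fin (nE D') → Fin (nE D)) λ ψ →
    tail D f ≢ head D f ×
    DPathAvoid D f (tail D f) (head D f) ×
    Injective _≡_ _≡_ φ × Surjective _≡_ _≡_ φ ×
    Injective _≡_ _≡_ ψ ×
    (∀ e → ψ e ≢ f) ×
    (∀ g → g ≢ f → ∃ λ e → ψ e ≡ g) ×
    (∀ e → φ (tail D' e) ≡ tail D (ψ e)) ×
    (∀ e → φ (head D' e) ≡ head D (ψ e))

IsolatedVertexDeletionOf : (D D' : Digraph) → Set
IsolatedVertexDeletionOf D D' =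
  Σ (Fin (nV D)) λ v →
  Σ (Fin (nV D') → Fin (nV D)) λ φ →
  Σ (Fin (nE D') → Fin (nE D)) λ ψ →
    (∀ e → (tail D e ≢ v) × (head D e ≢ v)) ×
    Injective _≡_ _≡_ φ ×
    (∀ u → φ u ≢ v) ×
    (∀ w → w ≢ v → ∃ λ u → φ u ≡ w) ×
    Injective _≡_ _≡_ ψ × Surjective _≡_ _≡_ ψ ×
    (∀ e → φ (tail D' e) ≡ tail D (ψ e)) ×
    (∀ e → φ (head D' e) ≡ head D (ψ e))

data Step (D D' : Digraph) : Set where
  contract  : ContractionOf D D' → Step D D'
  delEdge   : DeletableEdgeDeletionOf D D' → Step D D'
  delVertex : IsolatedVertexDeletionOf D D' → Step D D'

IsCutMinor : Digraph → Digraph → Set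
IsCutMinor D₁ D₂ = Star Step D₂ D₁

-- A directed bond is the cut δ(X) of a shore X that is nonempty, inclusion-minimal and left
-- by all of its edges, and J is an odd dijoin iff ∑ₑ J(e)·δ(X)(e) = 1 in 𝔽₂ for every such X.
-- Each cut-minor operation comes with an injective edge map ψ : E(D′) → E(D), and every
-- directed bond shore X′ of D′ lifts to a directed bond shore X of D with δ(X) ∘ ψ = δ(X′);
-- so restricting J along ψ keeps all parities as long as J·δ(X) vanishes off the image of ψ.
-- After a contraction or the deletion of an isolated vertex, δ(X) lies in that image. When a
-- deletable edge f is removed, an f-avoiding path P from the tail to the head of f fixes δ(X)(f)
-- as the parity of |P ∩ δ(X)|, and J is first replaced by J + J(f)·(P + f): the cycle P + f
-- meets every cut evenly, so no parity changes, and f leaves J.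

module Submission where

open import Defs
open import Algebra.Bundles using (CommutativeRing)
open import Data.Bool using (Bool; true; false; not; _∧_; _xor_; if_then_else_)
open import Data.Bool.Properties
  using ( xor-∧-commutativeRing; xor-identityʳ; xor-same; xor-assoc; ∧-zeroʳ; ∧-identityʳ; ∧-assoc
        ; ∧-distribʳ-xor; ¬-not; not-¬; ⇔→≡)
  renaming (_≟_ to _≟ᵇ_)
open import Data.Fin using (Fin; zero; suc)
open import Data.Fin.Properties using (_≟_; any?)
open import Data.Fin.Subset using (Subset; ∣_∣; _∈_; _∩_; _⊆_; Nonempty)
open import Data.Nat using (ℕ; suc; _+_; _%_)
open import Data.Nat.DivMod using (%-distribˡ-+)
open import Data.Product using (∃; _×_; _,_; proj₁; proj₂)
open import Data.Vec using ([]; _∷_; lookup; tabulate)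
open import Data.Vec.Properties using (lookup∘tabulate; lookup-zipWith; []=⇒lookup; lookup⇒[]=)
open import Function using (id; _∘_; _⇔_; mk⇔; Equivalence)
open import Function.Definitions using (Injective)
open import Relation.Binary.Construct.Closure.ReflexiveTransitive using (fold)
open import Relation.Binary.PropositionalEquality
open import Relation.Nullary using (does; yes; no; contradiction)
open import Relation.Nullary.Decidable using (dec-true; dec-false)
open import Algebra.Properties.Semiring.Sum (CommutativeRing.semiring xor-∧-commutativeRing)
  using (sum; sum-cong-≗; ∑-comm; ∑-distrib-+; *-distribˡ-sum; sum-replicate-zero)

open ≡-Reasoning

∑-indicator : ∀ {n} (x : Fin n) (h : Fin n → Bool) → sum (λ g → does (x ≟ g) ∧ h g) ≡ h x
∑-indicator {suc n} zero h = trans (cong (h zero xor_) (sum-replicate-zero n)) (xor-identityʳ (h zero))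
∑-indicator {suc n} (suc x) h = ∑-indicator x (h ∘ suc)

∑-false : ∀ n {h : Fin n → Bool} → (∀ g → h g ≡ false) → sum h ≡ false
∑-false n h≡false = trans (sum-cong-≗ h≡false) (sum-replicate-zero n)

does-≟-injective : ∀ {m n} {ψ : Fin m → Fin n} → Injective _≡_ _≡_ ψ →
                   ∀ x y → does (ψ x ≟ ψ y) ≡ does (y ≟ x)
does-≟-injective {ψ = ψ} ψ-inj x y with y ≟ x
... | yes refl = dec-true (ψ x ≟ ψ x) refl
... | no y≢x   = dec-false (ψ x ≟ ψ y) (λ ψx≡ψy → y≢x (sym (ψ-inj ψx≡ψy)))

∑-reindex : ∀ {m n} (ψ : Fin m → Fin n) → Injective _≡_ _≡_ ψ → (h : Fin n → Bool) →
            (∀ g → (∀ e → ψ e ≢ g) → h g ≡ false) → sum h ≡ sum (h ∘ ψ)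
-- Double counting over the pairs (e , g) with ψ e ≡ g.
∑-reindex {m} ψ ψ-inj h vanishes = begin
  sum h                                          ≡⟨ sum-cong-≗ fibre ⟩
  sum (λ g → sum (λ e → does (ψ e ≟ g) ∧ h g))   ≡⟨ ∑-comm (λ g e → does (ψ e ≟ g) ∧ h g) ⟩
  sum (λ e → sum (λ g → does (ψ e ≟ g) ∧ h g))   ≡⟨ sum-cong-≗ (λ e → ∑-indicator (ψ e) h) ⟩
  sum (h ∘ ψ)                                    ∎
  where
  fibre : ∀ g → h g ≡ sum (λ e → does (ψ e ≟ g) ∧ h g)
  fibre g with any? (λ e → ψ e ≟ g)
  ... | yes (e₀ , refl) =
    sym (trans (sum-cong-≗ (λ e → cong (_∧ h (ψ e₀)) (does-≟-injective ψ-inj e e₀)))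
               (∑-indicator e₀ (λ _ → h (ψ e₀))))
  ... | no ∄e rewrite vanishes g (λ e ψe≡g → ∄e (e , ψe≡g)) = sym (∑-false m (λ _ → ∧-zeroʳ _))

bit : Bool → ℕ
bit b = if b then 1 else 0

count-parity : ∀ {n} (p : Subset n) → ∣ p ∣ % 2 ≡ bit (sum (lookup p))
count-parity []          = refl
count-parity (false ∷ p) = count-parity p
count-parity (true ∷ p)  = begin
  (1 + ∣ p ∣) % 2      ≡⟨ %-distribˡ-+ 1 ∣ p ∣ 2 ⟩
  (1 + ∣ p ∣ % 2) % 2  ≡⟨ cong (λ r → (1 + r) % 2) (count-parity p) ⟩
  (1 + bit s) % 2      ≡⟨ flip s ⟩
  bit (not s)          ∎
  where
  s = sum (lookup p)
  flip : ∀ b → (1 + bit b) % 2 ≡ bit (not b)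
  flip true  = refl
  flip false = refl

odd-size⇔odd-sum : ∀ {n} (p : Subset n) → ∣ p ∣ % 2 ≡ 1 ⇔ sum (lookup p) ≡ true
odd-size⇔odd-sum p = mk⇔ (bit≡1 ∘ trans (sym (count-parity p)))
                         (λ s≡true → trans (count-parity p) (cong bit s≡true))
  where
  bit≡1 : ∀ {b} → bit b ≡ 1 → b ≡ true
  bit≡1 {true} _ = refl

Shore : Digraph → Set
Shore D = Fin (nV D) → Bool

δ : (D : Digraph) → Shore D → Fin (nE D) → Bool
δ D X e = X (tail D e) xor X (head D e)

infix 4 _⊆ᵇ_
_⊆ᵇ_ : ∀ {n} → (Fin n → Bool) → (Fin n → Bool) → Set
P ⊆ᵇ Q = ∀ i → P i ≡ true → Q i ≡ true

record IsDirectedBondShore (D : Digraph) (X : Shore D) : Set where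
  field
    nonempty : ∃ λ e → δ D X e ≡ true
    minimal  : ∀ Y → (∃ λ e → δ D Y e ≡ true) → δ D Y ⊆ᵇ δ D X → δ D X ⊆ᵇ δ D Y
    outward  : ∀ e → δ D X e ≡ true → X (tail D e) ≡ true
open IsDirectedBondShore

IsOddDijoinᵇ : (D : Digraph) → (Fin (nE D) → Bool) → Set
IsOddDijoinᵇ D J = ∀ X → IsDirectedBondShore D X → sum (λ e → J e ∧ δ D X e) ≡ true

HasOddDijoinᵇ : Digraph → Set
HasOddDijoinᵇ D = ∃ (IsOddDijoinᵇ D)

δ-cong : ∀ D {X Y : Shore D} → X ≗ Y → δ D X ≗ δ D Y
δ-cong D X≗Y e = cong₂ _xor_ (X≗Y (tail D e)) (X≗Y (head D e))

IsDirectedBondShore-resp-≗ : ∀ {D} {X Y : Shore D} → X ≗ Y →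
                             IsDirectedBondShore D X → IsDirectedBondShore D Y
IsDirectedBondShore-resp-≗ {D} {X} {Y} X≗Y bond = record
  { nonempty = let e , c = nonempty bond in e , trans (sym (δX≗δY e)) c
  ; minimal  = λ Z ne Z⊆Y e c →
      minimal bond Z ne (λ g c′ → trans (δX≗δY g) (Z⊆Y g c′)) e (trans (δX≗δY e) c)
  ; outward  = λ e c → trans (sym (X≗Y (tail D e))) (outward bond e (trans (δX≗δY e) c))
  }
  where
  δX≗δY = δ-cong D X≗Y

lookup-cut : ∀ D (X : Subset (nV D)) e → lookup (cut D X) e ≡ δ D (lookup X) e
lookup-cut D X = lookup∘tabulate (δ D (lookup X))

∈cut⇒δ : ∀ D (X : Subset (nV D)) {e} → e ∈ cut D X → δ D (lookup X) e ≡ true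
∈cut⇒δ D X {e} e∈ = trans (sym (lookup-cut D X e)) ([]=⇒lookup e∈)

δ⇒∈cut : ∀ D (X : Subset (nV D)) {e} → δ D (lookup X) e ≡ true → e ∈ cut D X
δ⇒∈cut D X {e} c = lookup⇒[]= e (cut D X) (trans (lookup-cut D X e) c)

shore⇒directedBond : ∀ D (X : Subset (nV D)) →
                     IsDirectedBondShore D (lookup X) → IsDirectedBond D (cut D X)
shore⇒directedBond D X bond =
  ((X , refl) , (e₀ , δ⇒∈cut D X c₀) , minimal-cut) ,
  X , refl , λ e e∈ → outward bond e (∈cut⇒δ D X e∈)
  where
  e₀ = proj₁ (nonempty bond)
  c₀ = proj₂ (nonempty bond)
  minimal-cut : ∀ Y → Nonempty (cut D Y) → cut D Y ⊆ cut D X → cut D X ⊆ cut D Y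
  minimal-cut Y (g , g∈) Y⊆X e∈ =
    δ⇒∈cut D Y (minimal bond (lookup Y) (g , ∈cut⇒δ D Y g∈)
                  (λ _ c → ∈cut⇒δ D X (Y⊆X (δ⇒∈cut D Y c))) _ (∈cut⇒δ D X e∈))

directedBond⇒shore : ∀ D {S} → IsDirectedBond D S →
                     ∃ λ X → S ≡ cut D X × IsDirectedBondShore D (lookup X)
directedBond⇒shore D ((_ , (g , g∈S) , minimal-S) , X , refl , outward-S) = X , refl , record
  { nonempty = g , ∈cut⇒δ D X g∈S
  ; minimal  = minimal-shore
  ; outward  = λ e c → outward-S e (δ⇒∈cut D X c)
  }
  where
  minimal-shore : ∀ Y → (∃ λ e → δ D Y e ≡ true) → δ D Y ⊆ᵇ δ D (lookup X) → δ D (lookup X) ⊆ᵇ δ D Y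
  minimal-shore Y (e , c) Y⊆X g c′ =
    trans (sym (δY g)) (∈cut⇒δ D (tabulate Y)
      (minimal-S (tabulate Y) (e , δ⇒∈cut D (tabulate Y) (trans (δY e) c))
        (λ {h} h∈ → δ⇒∈cut D X (Y⊆X h (trans (sym (δY h)) (∈cut⇒δ D (tabulate Y) h∈))))
        (δ⇒∈cut D X c′)))
    where
    δY = δ-cong D (lookup∘tabulate Y)

lookup-∩-cut : ∀ D (J : Subset (nE D)) (X : Subset (nV D)) e →
               lookup (J ∩ cut D X) e ≡ lookup J e ∧ δ D (lookup X) e
lookup-∩-cut D J X e =
  trans (lookup-zipWith _∧_ e J (cut D X)) (cong (lookup J e ∧_) (lookup-cut D X e))

hasOddDijoin⇒ᵇ : ∀ D → HasOddDijoin D → HasOddDijoinᵇ D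
hasOddDijoin⇒ᵇ D (J , odd) = lookup J , λ X bond →
  let S = cut D (tabulate X)
      S-bond = shore⇒directedBond D (tabulate X)
                 (IsDirectedBondShore-resp-≗ (sym ∘ lookup∘tabulate X) bond)
  in trans (sum-cong-≗ (λ e → trans (cong (lookup J e ∧_) (sym (δ-cong D (lookup∘tabulate X) e)))
                                    (sym (lookup-∩-cut D J (tabulate X) e))))
           (Equivalence.to (odd-size⇔odd-sum (J ∩ S)) (odd S S-bond))

hasOddDijoinᵇ⇒ : ∀ D → HasOddDijoinᵇ D → HasOddDijoin D
hasOddDijoinᵇ⇒ D (J , odd) = tabulate J , λ S S-bond →
  let X , S≡cut , bond = directedBond⇒shore D S-bond
  in subst (λ S → ∣ tabulate J ∩ S ∣ % 2 ≡ 1) (sym S≡cut)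
       (Equivalence.from (odd-size⇔odd-sum (tabulate J ∩ cut D X))
         (trans (sum-cong-≗ (λ e → trans (lookup-∩-cut D (tabulate J) X e)
                                         (cong (_∧ δ D (lookup X) e) (lookup∘tabulate J e))))
                (odd (lookup X) bond)))

module _ {D D′ : Digraph} (ψ : Fin (nE D′) → Fin (nE D)) where

  DirectedBondLift : (Fin (nE D) → Bool) → Shore D′ → Shore D → Set
  DirectedBondLift J X′ X =
    IsDirectedBondShore D X × (∀ e → δ D X (ψ e) ≡ δ D′ X′ e) ×
    (∀ g → (∀ e → ψ e ≢ g) → J g ∧ δ D X g ≡ false)

  restrict-oddDijoin :
    Injective _≡_ _≡_ ψ → ∀ {J} → IsOddDijoinᵇ D J →
    (∀ X′ → IsDirectedBondShore D′ X′ → ∃ (DirectedBondLift J X′)) → IsOddDijoinᵇ D′ (J ∘ ψ)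
  restrict-oddDijoin ψ-inj {J} odd lift X′ bond′ =
    let X , bond , δ-ψ , vanishes = lift X′ bond′ in begin
      sum (λ e → J (ψ e) ∧ δ D′ X′ e)   ≡⟨ sum-cong-≗ (λ e → cong (J (ψ e) ∧_) (δ-ψ e)) ⟨
      sum (λ e → J (ψ e) ∧ δ D X (ψ e)) ≡⟨ ∑-reindex ψ ψ-inj (λ g → J g ∧ δ D X g) vanishes ⟨
      sum (λ g → J g ∧ δ D X g)         ≡⟨ odd X bond ⟩
      true                              ∎

  lift-directedBondShore :
    ∀ {X′ X} → IsDirectedBondShore D′ X′ →
    (∀ e → δ D X (ψ e) ≡ δ D′ X′ e) →
    (∀ Y → δ D Y ⊆ᵇ δ D X → ∃ λ Y′ → ∀ e → δ D′ Y′ e ≡ δ D Y (ψ e)) →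
    (∀ Y Z → δ D Y ⊆ᵇ δ D X → δ D Z ⊆ᵇ δ D X → (∀ e → δ D Y (ψ e) ≡ δ D Z (ψ e)) → δ D Y ≗ δ D Z) →
    (∀ g → δ D X g ≡ true → X (tail D g) ≡ true) →
    IsDirectedBondShore D X
  lift-directedBondShore {X′} {X} bond′ δ-ψ descend determined out = record
    { nonempty = let e , c = nonempty bond′ in ψ e , trans (δ-ψ e) c
    ; minimal  = minimal-lift
    ; outward  = out
    }
    where
    minimal-lift : ∀ Y → (∃ λ e → δ D Y e ≡ true) → δ D Y ⊆ᵇ δ D X → δ D X ⊆ᵇ δ D Y
    minimal-lift Y (g , c) Y⊆X with any? (λ e → δ D Y (ψ e) ≟ᵇ true)
    ... | no ∄e = contradiction (determined Y ∅ Y⊆X (λ _ ()) (λ e → ¬-not (∄e ∘ (e ,_))) g) (not-¬ c)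
      where
      ∅ : Shore D
      ∅ _ = false
    ... | yes (e , c′) = λ h c″ → trans (determined Y X Y⊆X (λ _ c‴ → c‴) agree h) c″
      where
      Y′ = proj₁ (descend Y Y⊆X)
      δ-Y′ = proj₂ (descend Y Y⊆X)
      X′⊆Y′ : δ D′ X′ ⊆ᵇ δ D′ Y′
      X′⊆Y′ = minimal bond′ Y′ (e , trans (δ-Y′ e) c′)
                (λ e c‴ → trans (sym (δ-ψ e)) (Y⊆X (ψ e) (trans (sym (δ-Y′ e)) c‴)))
      agree : ∀ e → δ D Y (ψ e) ≡ δ D X (ψ e)
      agree e = ⇔→≡ (mk⇔ (λ c‴ → Y⊆X (ψ e) c‴)
                         (λ c‴ → trans (sym (δ-Y′ e)) (X′⊆Y′ e (trans (sym (δ-ψ e)) c‴))))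

  record SupportedLift (X′ : Shore D′) (X : Shore D) : Set where
    field
      δ-ψ       : ∀ e → δ D X (ψ e) ≡ δ D′ X′ e
      tail-ψ    : ∀ e → X (tail D (ψ e)) ≡ X′ (tail D′ e)
      supported : ∀ g → δ D X g ≡ true → ∃ λ e → ψ e ≡ g
      descend   : ∀ Y → δ D Y ⊆ᵇ δ D X → ∃ λ Y′ → ∀ e → δ D′ Y′ e ≡ δ D Y (ψ e)

  restrict-oddDijoin-supported :
    Injective _≡_ _≡_ ψ → ∀ {J} → IsOddDijoinᵇ D J →
    (∀ X′ → ∃ (SupportedLift X′)) → IsOddDijoinᵇ D′ (J ∘ ψ)
  restrict-oddDijoin-supported ψ-inj {J} odd lifts = restrict-oddDijoin ψ-inj odd lift
    where
    lift : ∀ X′ → IsDirectedBondShore D′ X′ → ∃ (DirectedBondLift J X′)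
    lift X′ bond′ = X , lift-directedBondShore bond′ δ-ψ descend determined out , δ-ψ , vanishes
      where
      X = proj₁ (lifts X′)
      open SupportedLift (proj₂ (lifts X′))

      outside : ∀ {g} → (∀ e → ψ e ≢ g) → δ D X g ≡ false
      outside {g} ∉img = ¬-not (λ c → let e , ψe≡g = supported g c in ∉img e ψe≡g)

      vanishes : ∀ g → (∀ e → ψ e ≢ g) → J g ∧ δ D X g ≡ false
      vanishes g ∉img = trans (cong (J g ∧_) (outside ∉img)) (∧-zeroʳ (J g))

      determined : ∀ Y Z → δ D Y ⊆ᵇ δ D X → δ D Z ⊆ᵇ δ D X →
                   (∀ e → δ D Y (ψ e) ≡ δ D Z (ψ e)) → δ D Y ≗ δ D Z
      determined Y Z Y⊆X Z⊆X agree g with any? (λ e → ψ e ≟ g)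
      ... | yes (e , refl) = agree e
      ... | no ∄e = trans (off Y Y⊆X) (sym (off Z Z⊆X))
        where
        off : ∀ W → δ D W ⊆ᵇ δ D X → δ D W g ≡ false
        off W W⊆X = ¬-not (λ c → ∄e (supported g (W⊆X g c)))

      out : ∀ g → δ D X g ≡ true → X (tail D g) ≡ true
      out g c with supported g c
      ... | e , refl = trans (tail-ψ e) (outward bond′ e (trans (sym (δ-ψ e)) c))

IsOddDijoinᵇ-+even : ∀ {D J} (C : Fin (nE D) → Bool) → (∀ Z → sum (λ g → C g ∧ δ D Z g) ≡ false) →
                     IsOddDijoinᵇ D J → ∀ b → IsOddDijoinᵇ D (λ g → J g xor (b ∧ C g))
IsOddDijoinᵇ-+even {D} {J} C C-even odd b X bond = begin
  sum (λ g → (J g xor (b ∧ C g)) ∧ δ D X g)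
    ≡⟨ sum-cong-≗ distrib ⟩
  sum (λ g → (J g ∧ δ D X g) xor (b ∧ (C g ∧ δ D X g)))
    ≡⟨ ∑-distrib-+ {nE D} _ _ ⟩
  sum (λ g → J g ∧ δ D X g) xor sum (λ g → b ∧ (C g ∧ δ D X g))
    ≡⟨ cong₂ _xor_ (odd X bond) (sym (*-distribˡ-sum b (λ g → C g ∧ δ D X g))) ⟩
  true xor (b ∧ sum (λ g → C g ∧ δ D X g))
    ≡⟨ cong (λ s → true xor (b ∧ s)) (C-even X) ⟩
  true xor (b ∧ false)
    ≡⟨ cong (true xor_) (∧-zeroʳ b) ⟩
  true
    ∎
  where
  distrib : ∀ g → (J g xor (b ∧ C g)) ∧ δ D X g ≡ (J g ∧ δ D X g) xor (b ∧ (C g ∧ δ D X g))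
  distrib g = trans (∧-distribʳ-xor (δ D X g) (J g) (b ∧ C g))
                    (cong (J g ∧ δ D X g xor_) (∧-assoc b (C g) (δ D X g)))

WConn-invariant : ∀ {D A} (W : Shore D) → (∀ g → g ∈ A → W (tail D g) ≡ W (head D g)) →
                  ∀ {u v} → WConn D A u v → W u ≡ W v
WConn-invariant W const here          = refl
WConn-invariant W const (fwd e e∈A c) = trans (const e e∈A) (WConn-invariant W const c)
WConn-invariant W const (bwd e e∈A c) = trans (sym (const e e∈A)) (WConn-invariant W const c)

xor≡false⇒≡ : ∀ {a b} → a xor b ≡ false → a ≡ b
xor≡false⇒≡ {false} {false} _ = refl
xor≡false⇒≡ {true}  {true}  _ = refl

extend : ∀ {m n} → (Fin m → Fin n) → (Fin m → Bool) → Fin n → Bool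
extend φ X′ w with any? (λ u → φ u ≟ w)
... | yes (u , _) = X′ u
... | no _        = false

extend-∘ : ∀ {m n} {φ : Fin m → Fin n} → Injective _≡_ _≡_ φ → ∀ X′ u → extend φ X′ (φ u) ≡ X′ u
extend-∘ {φ = φ} φ-inj X′ u with any? (λ u′ → φ u′ ≟ φ u)
... | yes (u′ , φu′≡φu) = cong X′ (φ-inj φu′≡φu)
... | no ∄u′            = contradiction (u , refl) ∄u′

module Homomorphism {D D′ : Digraph} {φ : Fin (nV D′) → Fin (nV D)} {ψ : Fin (nE D′) → Fin (nE D)}
         (tail-φ : ∀ e → φ (tail D′ e) ≡ tail D (ψ e))
         (head-φ : ∀ e → φ (head D′ e) ≡ head D (ψ e)) where

  δ-∘ : ∀ Y e → δ D′ (Y ∘ φ) e ≡ δ D Y (ψ e)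
  δ-∘ Y e = cong₂ _xor_ (cong Y (tail-φ e)) (cong Y (head-φ e))

  module _ (φ-inj : Injective _≡_ _≡_ φ) (X′ : Shore D′) where

    δ-extend : ∀ e → δ D (extend φ X′) (ψ e) ≡ δ D′ X′ e
    δ-extend e = trans (sym (δ-∘ (extend φ X′) e)) (δ-cong D′ (extend-∘ φ-inj X′) e)

    tail-extend : ∀ e → extend φ X′ (tail D (ψ e)) ≡ X′ (tail D′ e)
    tail-extend e = trans (cong (extend φ X′) (sym (tail-φ e))) (extend-∘ φ-inj X′ (tail D′ e))

walkEdges : ∀ {D f u w} → DPathAvoid D f u w → Fin (nE D) → Bool
walkEdges here         g = false
walkEdges (step e _ P) g = does (e ≟ g) xor walkEdges P g

walkEdges-avoids : ∀ {D f u w} (P : DPathAvoid D f u w) → walkEdges P f ≡ false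
walkEdges-avoids             here           = refl
walkEdges-avoids {f = f} (step e e≢f P) = cong₂ _xor_ (dec-false (e ≟ f) e≢f) (walkEdges-avoids P)

∑-walkEdges-δ : ∀ {D f u w} (P : DPathAvoid D f u w) (Z : Shore D) →
                sum (λ g → walkEdges P g ∧ δ D Z g) ≡ Z u xor Z w
∑-walkEdges-δ {D} {u = u} here Z = trans (sum-replicate-zero (nE D)) (sym (xor-same (Z u)))
∑-walkEdges-δ {D} {w = w} (step e _ P) Z = begin
  sum (λ g → (does (e ≟ g) xor walkEdges P g) ∧ δ D Z g)
    ≡⟨ sum-cong-≗ (λ g → ∧-distribʳ-xor (δ D Z g) (does (e ≟ g)) (walkEdges P g)) ⟩
  sum (λ g → (does (e ≟ g) ∧ δ D Z g) xor (walkEdges P g ∧ δ D Z g))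
    ≡⟨ ∑-distrib-+ {nE D} _ _ ⟩
  sum (λ g → does (e ≟ g) ∧ δ D Z g) xor sum (λ g → walkEdges P g ∧ δ D Z g)
    ≡⟨ cong₂ _xor_ (∑-indicator e (δ D Z)) (∑-walkEdges-δ P Z) ⟩
  (Z t xor Z h) xor (Z h xor Z w)
    ≡⟨ xor-assoc (Z t) (Z h) (Z h xor Z w) ⟩
  Z t xor (Z h xor (Z h xor Z w))
    ≡⟨ cong (Z t xor_) (trans (sym (xor-assoc (Z h) (Z h) (Z w))) (cong (_xor Z w) (xor-same (Z h)))) ⟩
  Z t xor Z w
    ∎
  where
  t = tail D e
  h = head D e

walk-enters : ∀ {D f u w} → DPathAvoid D f u w → (X : Shore D) → X u ≡ false → X w ≡ true →
              ∃ λ e → e ≢ f × X (tail D e) ≡ false × X (head D e) ≡ true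
walk-enters here X Xu≡false Xw≡true = contradiction Xu≡false (not-¬ Xw≡true)
walk-enters {D} (step e e≢f P) X Xu≡false Xw≡true with X (head D e) in eq
... | true  = e , e≢f , Xu≡false , eq
... | false = walk-enters P X eq Xw≡true

module Bypass {D : Digraph} {f : Fin (nE D)} (P : DPathAvoid D f (tail D f) (head D f)) where

  δ-determined-off : ∀ Y Z → (∀ g → g ≢ f → δ D Y g ≡ δ D Z g) → δ D Y ≗ δ D Z
  δ-determined-off Y Z agree g with g ≟ f
  ... | no g≢f   = agree g g≢f
  ... | yes refl = begin
    δ D Y f                                ≡⟨ ∑-walkEdges-δ P Y ⟨
    sum (λ g → walkEdges P g ∧ δ D Y g)    ≡⟨ sum-cong-≗ agree-on-walk ⟩
    sum (λ g → walkEdges P g ∧ δ D Z g)    ≡⟨ ∑-walkEdges-δ P Z ⟩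
    δ D Z f                                ∎
    where
    agree-on-walk : ∀ g → walkEdges P g ∧ δ D Y g ≡ walkEdges P g ∧ δ D Z g
    agree-on-walk g with g ≟ f
    ... | yes refl rewrite walkEdges-avoids P = refl
    ... | no g≢f   = cong (walkEdges P g ∧_) (agree g g≢f)

  outward-extends : ∀ X → (∀ g → g ≢ f → δ D X g ≡ true → X (tail D g) ≡ true) →
                    ∀ g → δ D X g ≡ true → X (tail D g) ≡ true
  outward-extends X out g c with g ≟ f
  ... | no g≢f = out g g≢f c
  ... | yes refl with X (tail D f) in eq
  ... | true  = refl
  ... | false =
    let e , e≢f , Xt≡false , Xh≡true = walk-enters P X eq c
    in contradiction Xt≡false (not-¬ (out e e≢f (cong₂ _xor_ Xt≡false Xh≡true)))

  cycle : Fin (nE D) → Bool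
  cycle g = walkEdges P g xor does (f ≟ g)

  cycle-f : cycle f ≡ true
  cycle-f = cong₂ _xor_ (walkEdges-avoids P) (dec-true (f ≟ f) refl)

  ∑-cycle-δ : ∀ Z → sum (λ g → cycle g ∧ δ D Z g) ≡ false
  ∑-cycle-δ Z = begin
    sum (λ g → cycle g ∧ δ D Z g)
      ≡⟨ sum-cong-≗ (λ g → ∧-distribʳ-xor (δ D Z g) (walkEdges P g) (does (f ≟ g))) ⟩
    sum (λ g → (walkEdges P g ∧ δ D Z g) xor (does (f ≟ g) ∧ δ D Z g))
      ≡⟨ ∑-distrib-+ {nE D} _ _ ⟩
    sum (λ g → walkEdges P g ∧ δ D Z g) xor sum (λ g → does (f ≟ g) ∧ δ D Z g)
      ≡⟨ cong₂ _xor_ (∑-walkEdges-δ P Z) (∑-indicator f (δ D Z)) ⟩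
    δ D Z f xor δ D Z f
      ≡⟨ xor-same (δ D Z f) ⟩
    false
      ∎

contraction-preserves : ∀ {D D′} → ContractionOf D D′ → HasOddDijoinᵇ D → HasOddDijoinᵇ D′
contraction-preserves {D} {D′}
  (A , φ , ψ , φ-surj , φ-fibres , ψ-inj , _ , ψ-onto , tail-ψ , head-ψ) (J , odd) =
  J ∘ ψ , restrict-oddDijoin-supported ψ ψ-inj odd (λ X′ → X′ ∘ φ , lift X′)
  where
  contracted : ∀ W g → g ∈ A → δ D (W ∘ φ) g ≡ false
  contracted W g g∈A =
    trans (cong (λ v → W v xor W (φ (head D g))) (Equivalence.from (φ-fibres _ _) (fwd g g∈A here)))
          (xor-same (W (φ (head D g))))

  lift : ∀ X′ → SupportedLift ψ X′ (X′ ∘ φ)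
  lift X′ = record
    { δ-ψ       = λ e → sym (cong₂ _xor_ (cong X′ (tail-ψ e)) (cong X′ (head-ψ e)))
    ; tail-ψ    = λ e → sym (cong X′ (tail-ψ e))
    ; supported = λ g c → ψ-onto g (λ g∈A → not-¬ c (contracted X′ g g∈A))
    ; descend   = descend
    }
    where
    descend : ∀ Y → δ D Y ⊆ᵇ δ D (X′ ∘ φ) → ∃ λ Y′ → ∀ e → δ D′ Y′ e ≡ δ D Y (ψ e)
    descend Y Y⊆X = Y′ , λ e → cong₂ _xor_ (trans (cong Y′ (tail-ψ e)) (Y′∘φ _))
                                            (trans (cong Y′ (head-ψ e)) (Y′∘φ _))
      where
      Y-const : ∀ g → g ∈ A → Y (tail D g) ≡ Y (head D g)
      Y-const g g∈A = xor≡false⇒≡ (¬-not (λ c → not-¬ (Y⊆X g c) (contracted X′ g g∈A)))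
      Y′ : Shore D′
      Y′ v = Y (proj₁ (φ-surj v))
      Y′∘φ : ∀ u → Y′ (φ u) ≡ Y u
      Y′∘φ u = let w , φw≡φu = φ-surj (φ u) in
               WConn-invariant Y Y-const (Equivalence.to (φ-fibres w u) (φw≡φu refl))

isolatedVertexDeletion-preserves : ∀ {D D′} → IsolatedVertexDeletionOf D D′ →
                                   HasOddDijoinᵇ D → HasOddDijoinᵇ D′
isolatedVertexDeletion-preserves {D} {D′}
  (_ , φ , ψ , _ , φ-inj , _ , _ , ψ-inj , ψ-surj , tail-φ , head-φ) (J , odd) =
  J ∘ ψ , restrict-oddDijoin-supported ψ ψ-inj odd (λ X′ → extend φ X′ , lift X′)
  where
  open Homomorphism {D} {D′} {φ} {ψ} tail-φ head-φ
  lift : ∀ X′ → SupportedLift ψ X′ (extend φ X′)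
  lift X′ = record
    { δ-ψ       = δ-extend φ-inj X′
    ; tail-ψ    = tail-extend φ-inj X′
    ; supported = λ g _ → let e , ψe≡g = ψ-surj g in e , ψe≡g refl
    ; descend   = λ Y _ → Y ∘ φ , δ-∘ Y
    }

deletableEdgeDeletion-preserves : ∀ {D D′} → DeletableEdgeDeletionOf D D′ →
                                  HasOddDijoinᵇ D → HasOddDijoinᵇ D′
deletableEdgeDeletion-preserves {D} {D′}
  (f , φ , ψ , _ , P , φ-inj , _ , ψ-inj , _ , ψ-onto , tail-φ , head-φ) (J , odd) =
  J̃ ∘ ψ , restrict-oddDijoin ψ ψ-inj (IsOddDijoinᵇ-+even cycle ∑-cycle-δ odd (J f)) lift
  where
  open Homomorphism {D} {D′} {φ} {ψ} tail-φ head-φ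
  open Bypass P

  J̃ : Fin (nE D) → Bool
  J̃ g = J g xor (J f ∧ cycle g)

  J̃f≡false : J̃ f ≡ false
  J̃f≡false = trans (cong (λ b → J f xor (J f ∧ b)) cycle-f)
                   (trans (cong (J f xor_) (∧-identityʳ (J f))) (xor-same (J f)))

  lift : ∀ X′ → IsDirectedBondShore D′ X′ → ∃ (DirectedBondLift ψ J̃ X′)
  lift X′ bond′ = X , bond , δ-extend φ-inj X′ , vanishes
    where
    X = extend φ X′

    outward-off-f : ∀ g → g ≢ f → δ D X g ≡ true → X (tail D g) ≡ true
    outward-off-f g g≢f c with ψ-onto g g≢f
    ... | e , refl =
      trans (tail-extend φ-inj X′ e) (outward bond′ e (trans (sym (δ-extend φ-inj X′ e)) c))

    determined : ∀ Y Z → δ D Y ⊆ᵇ δ D X → δ D Z ⊆ᵇ δ D X →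
                 (∀ e → δ D Y (ψ e) ≡ δ D Z (ψ e)) → δ D Y ≗ δ D Z
    determined Y Z _ _ agree = δ-determined-off Y Z λ g g≢f →
      let e , ψe≡g = ψ-onto g g≢f in subst (λ g → δ D Y g ≡ δ D Z g) ψe≡g (agree e)

    bond : IsDirectedBondShore D X
    bond = lift-directedBondShore ψ bond′ (δ-extend φ-inj X′) (λ Y _ → Y ∘ φ , δ-∘ Y)
             determined (outward-extends X outward-off-f)

    vanishes : ∀ g → (∀ e → ψ e ≢ g) → J̃ g ∧ δ D X g ≡ false
    vanishes g ∉img with g ≟ f
    ... | yes refl = cong (_∧ δ D X f) J̃f≡false
    ... | no g≢f   = let e , ψe≡g = ψ-onto g g≢f in contradiction ψe≡g (∉img e)

step-preserves : ∀ {D D′} → Step D D′ → HasOddDijoinᵇ D → HasOddDijoinᵇ D′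
step-preserves (contract c)  = contraction-preserves c
step-preserves (delEdge d)   = deletableEdgeDeletion-preserves d
step-preserves (delVertex d) = isolatedVertexDeletion-preserves d

lemma4p2 : (D₁ D₂ : Digraph) → IsCutMinor D₁ D₂ → HasOddDijoin D₂ → HasOddDijoin D₁
lemma4p2 D₁ D₂ minor =
  hasOddDijoinᵇ⇒ D₁ ∘ preserved minor ∘ hasOddDijoin⇒ᵇ D₂
  where
  preserved : IsCutMinor D₁ D₂ → HasOddDijoinᵇ D₂ → HasOddDijoinᵇ D₁
  preserved = fold (λ D D′ → HasOddDijoinᵇ D → HasOddDijoinᵇ D′) (λ s k → k ∘ step-preserves s) id
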